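{- For every set of formulas $\Gamma$ and formula $\phi$: if $\Gamma\vdash_s\phi$ then $\{\gamma=\top\mid\gamma\in\Gamma\}\models_{\mathcal{BHA}}\phi=\top$.
   Context: Fix a countably infinite set $\mathrm{Prop}$ of propositional variables. Bi-intuitionistic formulas are generated by $\phi ::= p \mid \bot \mid \top \mid \phi\wedge\phi \mid \phi\vee\phi \mid \phi\to\phi \mid \phi\prec\phi$ with $p\in\mathrm{Prop}$ ($\prec$ is exclusion). Abbreviations: $\neg\phi := \phi\to\bot$, ${\sim}\phi := \top\prec\phi$. An axiom is any instance of: (A1) $\phi\to(\psi\to\phi)$; (A2) $(\phi\to(\psi\to\chi))\to((\phi\to\psi)\to(\phi\to\chi))$; (A3) $\phi\to(\phi\vee\psi)$; (A4) $\psi\to(\phi\vee\psi)$; (A5) $(\phi\to\chi)\to((\psi\to\chi)\to((\phi\vee\psi)\to\chi))$; (A6) $(\phi\wedge\psi)\to\phi$; (A7) $(\phi\wedge\psi)\to\psi$; (A8) $(\chi\to\phi)\to((\chi\to\psi)\to(\chi\to(\phi\wedge\psi)))$; (A9) $\bot\to\phi$; (A10) $\phi\to\top$; (A11) $\phi\to(\psi\vee(\phi\prec\psi))$; (A12) $(\phi\prec\psi)\to{\sim}(\phi\to\psi)$; (A13) $((\phi\prec\psi)\prec\chi)\to(\phi\prec(\psi\vee\chi))$; (A14) $\neg(\phi\prec\psi)\to(\phi\to\psi)$. sBIL is the relation $\Gamma\vdash_s\phi$ holding iff $\Gamma\vdash\phi$ is derivable with: (Ax) $\Gamma\vdash\phi$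 for any axiom $\phi$; (El) $\Gamma\vdash\phi$ if $\phi\in\Gamma$; (MP) from $\Gamma\vdash\phi$ and $\Gamma\vdash\phi\to\psi$ infer $\Gamma\vdash\psi$; (sDN) from $\Gamma\vdash\phi$ infer $\Gamma\vdash\neg{\sim}\phi$. A bi-Heyting algebra is an algebra $(A,\top,\bot,\wedge,\vee,\to,\prec)$ whose reduct $(A,\top,\bot,\wedge,\vee)$ is a bounded lattice (order $a\le b$ iff $a=a\wedge b$) with $a\wedge b\le c\iff a\le b\to c$ and $a\le b\vee c\iff a\prec b\le c$ for all $a,b,c$; $\mathcal{BHA}$ is the class of all bi-Heyting algebras. A valuation $v:\mathrm{Prop}\to A$ extends to $\bar v$ on formulas. For a set of equations $\Theta$, $\Theta\models_{\mathcal{BHA}}\phi=\psi$ means: for all $A\in\mathcal{BHA}$ and valuations $v$ on $A$, if $\bar v(\theta)=\bar v(\eta)$ for all $(\theta=\eta)\in\Theta$ then $\bar v(\phi)=\bar v(\psi)$. -}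

module Defs where

open import Level using (Level; suc; Setω)
open import Data.Nat using (ℕ)
open import Relation.Binary.PropositionalEquality using (_≡_)
open import Data.Product using (_×_)

Prop : Set
Prop = ℕ

infixr 4 _⇒_ _≺_
infixr 6 _∧′_
infixr 5 _∨′_

data Formula : Set where
  var  : Prop → Formula
  ⊥′   : Formula
  ⊤′   : Formula
  _∧′_ : Formula → Formula → Formula
  _∨′_ : Formula → Formula → Formula
  _⇒_  : Formula → Formula → Formula
  _≺_  : Formula → Formula → Formula

¬′_ : Formula → Formula
¬′ φ = φ ⇒ ⊥′

∼_ : Formula → Formula
∼ φ = ⊤′ ≺ φ

data Axiom : Formula → Set where
  A1  : ∀ φ ψ → Axiom (φ ⇒ (ψ ⇒ φ))
  A2  : ∀ φ ψ χ → Axiom ((φ ⇒ (ψ ⇒ χ)) ⇒ ((φ ⇒ ψ) ⇒ (φ ⇒ χ)))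
  A3  : ∀ φ ψ → Axiom (φ ⇒ (φ ∨′ ψ))
  A4  : ∀ φ ψ → Axiom (ψ ⇒ (φ ∨′ ψ))
  A5  : ∀ φ ψ χ → Axiom ((φ ⇒ χ) ⇒ ((ψ ⇒ χ) ⇒ ((φ ∨′ ψ) ⇒ χ)))
  A6  : ∀ φ ψ → Axiom ((φ ∧′ ψ) ⇒ φ)
  A7  : ∀ φ ψ → Axiom ((φ ∧′ ψ) ⇒ ψ)
  A8  : ∀ φ ψ χ → Axiom ((χ ⇒ φ) ⇒ ((χ ⇒ ψ) ⇒ (χ ⇒ (φ ∧′ ψ))))
  A9  : ∀ φ → Axiom (⊥′ ⇒ φ)
  A10 : ∀ φ → Axiom (φ ⇒ ⊤′)
  A11 : ∀ φ ψ → Axiom (φ ⇒ (ψ ∨′ (φ ≺ ψ)))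
  A12 : ∀ φ ψ → Axiom ((φ ≺ ψ) ⇒ (∼ (φ ⇒ ψ)))
  A13 : ∀ φ ψ χ → Axiom (((φ ≺ ψ) ≺ χ) ⇒ (φ ≺ (ψ ∨′ χ)))
  A14 : ∀ φ ψ → Axiom ((¬′ (φ ≺ ψ)) ⇒ (φ ⇒ ψ))

FormulaSet : Set₁
FormulaSet = Formula → Set

data _⊢s_ (Γ : FormulaSet) : Formula → Set where
  ax  : ∀ {φ} → Axiom φ → Γ ⊢s φ
  el  : ∀ {φ} → Γ φ → Γ ⊢s φ
  mp  : ∀ {φ ψ} → Γ ⊢s φ → Γ ⊢s (φ ⇒ ψ) → Γ ⊢s ψ
  sDN : ∀ {φ} → Γ ⊢s φ → Γ ⊢s (¬′ (∼ φ))

record BHA (ℓ : Level) : Set (suc ℓ) where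
  infixr 6 _⊓_
  infixr 5 _⊔_
  field
    Carrier : Set ℓ
    top bot : Carrier
    _⊓_ _⊔_ _⟶_ _∸_ : Carrier → Carrier → Carrier
    ⊓-comm  : ∀ a b → a ⊓ b ≡ b ⊓ a
    ⊔-comm  : ∀ a b → a ⊔ b ≡ b ⊔ a
    ⊓-assoc : ∀ a b c → (a ⊓ b) ⊓ c ≡ a ⊓ (b ⊓ c)
    ⊔-assoc : ∀ a b c → (a ⊔ b) ⊔ c ≡ a ⊔ (b ⊔ c)
    ⊓-absorb : ∀ a b → a ⊓ (a ⊔ b) ≡ a
    ⊔-absorb : ∀ a b → a ⊔ (a ⊓ b) ≡ a
    ⊓-top : ∀ a → a ⊓ top ≡ a
    ⊔-bot : ∀ a → a ⊔ bot ≡ a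

  _≤_ : Carrier → Carrier → Set ℓ
  a ≤ b = a ≡ a ⊓ b

  field
    ⟶-residual : ∀ a b c → ((a ⊓ b) ≤ c → a ≤ (b ⟶ c)) × (a ≤ (b ⟶ c) → (a ⊓ b) ≤ c)
    ∸-residual : ∀ a b c → (a ≤ (b ⊔ c) → (a ∸ b) ≤ c) × ((a ∸ b) ≤ c → a ≤ (b ⊔ c))

module _ {ℓ} (A : BHA ℓ) where
  open BHA A

  ⟦_⟧ : Formula → (Prop → Carrier) → Carrier
  ⟦ var p ⟧ v = v p
  ⟦ ⊥′ ⟧ v = bot
  ⟦ ⊤′ ⟧ v = top
  ⟦ φ ∧′ ψ ⟧ v = ⟦ φ ⟧ v ⊓ ⟦ ψ ⟧ v
  ⟦ φ ∨′ ψ ⟧ v = ⟦ φ ⟧ v ⊔ ⟦ ψ ⟧ v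
  ⟦ φ ⇒ ψ ⟧ v = ⟦ φ ⟧ v ⟶ ⟦ ψ ⟧ v
  ⟦ φ ≺ ψ ⟧ v = ⟦ φ ⟧ v ∸ ⟦ ψ ⟧ v

Equations : Set₁
Equations = Formula → Formula → Set

_⊨BHA_≐_ : Equations → Formula → Formula → Setω
Θ ⊨BHA φ ≐ ψ = ∀ {ℓ} (A : BHA ℓ) (v : Prop → BHA.Carrier A) →
  (∀ θ η → Θ θ η → ⟦ A ⟧ θ v ≡ ⟦ A ⟧ η v) → ⟦ A ⟧ φ v ≡ ⟦ A ⟧ ψ v

topEqs : FormulaSet → Equations
topEqs Γ θ η = Γ θ × (η ≡ ⊤′)

-- Every axiom is an implication φ ⇒ ψ with
-- ⟦ φ ⟧ ≤ ⟦ ψ ⟧ in every bi-Heyting algebra, and a ⟶ b = ⊤ exactly when a ≤ b;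
-- so axioms evaluate to ⊤ and MP preserves ⊤. For sDN, ⊤ ≤ a gives ⊤ ∸ a ≤ ⊥,
-- whence ¬ ∼ a = (⊤ ∸ a) ⟶ ⊥ = ⊤.
module Submission where

open import Defs
open import Data.Product using (_,_; proj₁; proj₂)
import Relation.Binary.PropositionalEquality as ≡
open ≡ using (_≡_; sym; cong; cong₂; isEquivalence; module ≡-Reasoning)
open import Algebra.Lattice.Bundles using (Lattice)
open import Relation.Binary.Lattice using (HeytingAlgebra)
import Algebra.Lattice.Properties.Lattice as LatticeProperties
import Relation.Binary.Lattice.Properties.HeytingAlgebra as HeytingAlgebraProperties
import Relation.Binary.Lattice.Properties.JoinSemilattice as JoinSemilatticeProperties
import Relation.Binary.Lattice.Properties.MeetSemilattice as MeetSemilatticeProperties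
import Relation.Binary.Reasoning.PartialOrder as ≤-Reasoning

module BHAProperties {ℓ} (A : BHA ℓ) where
  open BHA A

  lattice : Lattice ℓ ℓ
  lattice = record
    { Carrier   = Carrier
    ; _≈_       = _≡_
    ; _∨_       = _⊔_
    ; _∧_       = _⊓_
    ; isLattice = record
      { isEquivalence = isEquivalence
      ; ∨-comm        = ⊔-comm
      ; ∨-assoc       = ⊔-assoc
      ; ∨-cong        = cong₂ _⊔_
      ; ∧-comm        = ⊓-comm
      ; ∧-assoc       = ⊓-assoc
      ; ∧-cong        = cong₂ _⊓_
      ; absorptive    = ⊔-absorb , ⊓-absorb
      }
    }

  bot-minimum : ∀ a → bot ≤ a
  bot-minimum a = begin
    bot                 ≡⟨ ⊓-absorb bot a ⟨
    bot ⊓ (bot ⊔ a)     ≡⟨ cong (bot ⊓_) (⊔-comm bot a) ⟩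
    bot ⊓ (a ⊔ bot)     ≡⟨ cong (bot ⊓_) (⊔-bot a) ⟩
    bot ⊓ a             ∎
    where open ≡-Reasoning

  -- The standard library orders an algebraic lattice by a ≈ a ∧ b, which is
  -- definitionally BHA._≤_; so ⟶-residual is literally its exponential law.
  heytingAlgebra : HeytingAlgebra ℓ ℓ ℓ
  heytingAlgebra = record
    { isHeytingAlgebra = record
      { isBoundedLattice = record
        { isLattice = LatticeProperties.∨-∧-isOrderTheoreticLattice lattice
        ; maximum   = λ a → sym (⊓-top a)
        ; minimum   = bot-minimum
        }
      ; exponential = ⟶-residual
      }
    }

  open HeytingAlgebra heytingAlgebra
    using (refl; trans; reflexive; antisym; poset; maximum; minimum; transpose-⇨;
           x≤x∨y; y≤x∨y; ∨-least; x∧y≤x; x∧y≤y; ∧-greatest; joinSemilattice; meetSemilattice)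
  open HeytingAlgebraProperties heytingAlgebra
    using (y≤x⇨y; ⇨-applyˡ; ⇨-applyʳ; ⇨-eval; ∧-distribˡ-∨-≤;
           ⇨-distribˡ-∧-≥; ⇨-distribˡ-∨-∧-≥)
  open JoinSemilatticeProperties joinSemilattice using (∨-monotonic)
  open MeetSemilatticeProperties meetSemilattice using (∧-monotonic)
  open ≤-Reasoning poset

  transpose-∸ : ∀ {a b c} → a ≤ (b ⊔ c) → (a ∸ b) ≤ c
  transpose-∸ {a} {b} {c} = proj₁ (∸-residual a b c)

  ∸-coeval : ∀ {a b} → a ≤ (b ⊔ (a ∸ b))
  ∸-coeval {a} {b} = proj₂ (∸-residual a b (a ∸ b)) refl

  ⟶-top⇒≤ : ∀ {a b} → a ⟶ b ≡ top → a ≤ b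
  ⟶-top⇒≤ {a} {b} a⟶b≡top = begin
    a              ≤⟨ ∧-greatest (maximum a) refl ⟩
    top ⊓ a        ≡⟨ cong (_⊓ a) a⟶b≡top ⟨
    (a ⟶ b) ⊓ a    ≤⟨ ⇨-eval ⟩
    b              ∎

  ≤⇒⟶-top : ∀ {a b} → a ≤ b → a ⟶ b ≡ top
  ≤⇒⟶-top a≤b = antisym (maximum _) (transpose-⇨ (trans (x∧y≤y _ _) a≤b))

  top≤⇒≡top : ∀ {a} → top ≤ a → a ≡ top
  top≤⇒≡top = antisym (maximum _)

  ⟶-top-mp : ∀ {a b} → a ≡ top → a ⟶ b ≡ top → b ≡ top
  ⟶-top-mp a≡top a⟶b≡top = top≤⇒≡top (trans (reflexive (sym a≡top)) (⟶-top⇒≤ a⟶b≡top))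

  ¬∼-top : ∀ {a} → a ≡ top → (top ∸ a) ⟶ bot ≡ top
  ¬∼-top {a} a≡top = ≤⇒⟶-top (transpose-∸ (trans (reflexive (sym a≡top)) (x≤x∨y a bot)))

  ⟶-S : ∀ {a b c} → (a ⟶ (b ⟶ c)) ≤ ((a ⟶ b) ⟶ (a ⟶ c))
  ⟶-S {a} {b} {c} = transpose-⇨ (transpose-⇨ (begin
    ((a ⟶ (b ⟶ c)) ⊓ (a ⟶ b)) ⊓ a  ≤⟨ ∧-greatest (trans (∧-monotonic (x∧y≤x _ _) refl) ⇨-eval)
                                                  (trans (∧-monotonic (x∧y≤y _ _) refl) ⇨-eval) ⟩
    (b ⟶ c) ⊓ b                      ≤⟨ ⇨-eval ⟩
    c                                ∎))

  ∸-≤-∼⟶ : ∀ {a b} → (a ∸ b) ≤ (top ∸ (a ⟶ b))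
  ∸-≤-∼⟶ {a} {b} = transpose-∸ (begin
    a                                      ≤⟨ ∧-greatest refl (trans (maximum a) ∸-coeval) ⟩
    a ⊓ ((a ⟶ b) ⊔ ∼a⟶b)                   ≤⟨ ∧-distribˡ-∨-≤ _ _ _ ⟩
    (a ⊓ (a ⟶ b)) ⊔ (a ⊓ ∼a⟶b)             ≤⟨ ∨-monotonic (⇨-applyʳ refl) (x∧y≤y _ _) ⟩
    b ⊔ ∼a⟶b                               ∎)
    where ∼a⟶b = top ∸ (a ⟶ b)

  ∸-∸-≤-∸-⊔ : ∀ {a b c} → ((a ∸ b) ∸ c) ≤ (a ∸ (b ⊔ c))
  ∸-∸-≤-∸-⊔ {a} {b} {c} = transpose-∸ (transpose-∸ (begin
    a                              ≤⟨ ∸-coeval ⟩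
    (b ⊔ c) ⊔ (a ∸ (b ⊔ c))        ≡⟨ ⊔-assoc b c _ ⟩
    b ⊔ (c ⊔ (a ∸ (b ⊔ c)))        ∎))

  ¬∸-≤-⟶ : ∀ {a b} → ((a ∸ b) ⟶ bot) ≤ (a ⟶ b)
  ¬∸-≤-⟶ {a} {b} = transpose-⇨ (begin
    n ⊓ a                        ≤⟨ ∧-monotonic refl ∸-coeval ⟩
    n ⊓ (b ⊔ (a ∸ b))            ≤⟨ ∧-distribˡ-∨-≤ _ _ _ ⟩
    (n ⊓ b) ⊔ (n ⊓ (a ∸ b))      ≤⟨ ∨-least (x∧y≤y _ _) (trans (⇨-applyˡ refl) (minimum b)) ⟩
    b                            ∎)
    where n = (a ∸ b) ⟶ bot

  axiom-top : ∀ {φ} (v : Prop → Carrier) → Axiom φ → ⟦ A ⟧ φ v ≡ top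
  axiom-top v (A1 φ ψ)     = ≤⇒⟶-top y≤x⇨y
  axiom-top v (A2 φ ψ χ)   = ≤⇒⟶-top ⟶-S
  axiom-top v (A3 φ ψ)     = ≤⇒⟶-top (x≤x∨y _ _)
  axiom-top v (A4 φ ψ)     = ≤⇒⟶-top (y≤x∨y _ _)
  axiom-top v (A5 φ ψ χ)   = ≤⇒⟶-top (transpose-⇨ (⇨-distribˡ-∨-∧-≥ _ _ _))
  axiom-top v (A6 φ ψ)     = ≤⇒⟶-top (x∧y≤x _ _)
  axiom-top v (A7 φ ψ)     = ≤⇒⟶-top (x∧y≤y _ _)
  axiom-top v (A8 φ ψ χ)   = ≤⇒⟶-top (transpose-⇨ (⇨-distribˡ-∧-≥ _ _ _))
  axiom-top v (A9 φ)       = ≤⇒⟶-top (minimum _)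
  axiom-top v (A10 φ)      = ≤⇒⟶-top (maximum _)
  axiom-top v (A11 φ ψ)    = ≤⇒⟶-top ∸-coeval
  axiom-top v (A12 φ ψ)    = ≤⇒⟶-top ∸-≤-∼⟶
  axiom-top v (A13 φ ψ χ)  = ≤⇒⟶-top ∸-∸-≤-∸-⊔
  axiom-top v (A14 φ ψ)    = ≤⇒⟶-top ¬∸-≤-⟶

open BHAProperties using (axiom-top; ⟶-top-mp; ¬∼-top)

mainTheorem15 : (Γ : FormulaSet) (φ : Formula) → Γ ⊢s φ → topEqs Γ ⊨BHA φ ≐ ⊤′
mainTheorem15 Γ _ (ax α)   A v Γ-top = axiom-top A v α
mainTheorem15 Γ φ (el γ)   A v Γ-top = Γ-top φ ⊤′ (γ , ≡.refl)
mainTheorem15 Γ _ (mp d e) A v Γ-top =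
  ⟶-top-mp A (mainTheorem15 Γ _ d A v Γ-top) (mainTheorem15 Γ _ e A v Γ-top)
mainTheorem15 Γ _ (sDN d)  A v Γ-top = ¬∼-top A (mainTheorem15 Γ _ d A v Γ-top)
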